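{- Let $m\ge 3$. Then (i) $\gamma_s(C_n\times K_m)=n$ for every $n\ge 3$; and (ii) $\gamma_s(C_2\times K_m)=3$ if $m=3$, and $\gamma_s(C_2\times K_m)=4$ if $m\ge 4$.
   Context: $C_n$ is the cycle on $\{1,\dots,n\}$ with edges $\{i,i+1\}$ and $\{n,1\}$, where $C_2$ is understood as the graph on $\{1,2\}$ with the single edge $\{1,2\}$; $K_m$ is the complete graph on $\{1,\dots,m\}$. The direct product $G\times H$ has vertex set $V(G)\times V(H)$ with $(g_1,h_1)\sim(g_2,h_2)$ iff $g_1g_2\in E(G)$ and $h_1h_2\in E(H)$. A set $D$ is dominating if every vertex not in $D$ is adjacent to a vertex of $D$. A set $S$ is a secure dominating set if it is dominating and for every vertex $w\notin S$ there is a neighbor $v\in S$ of $w$ such that $(S\setminus\{v\})\cup\{w\}$ is dominating; $\gamma_s(G)$ is the minimum size of a secure dominating set. -}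

module Defs where

open import Data.Nat using (ℕ; suc; _+_; _≤_; NonZero)
open import Data.Nat.DivMod using (_%_)
open import Data.Fin using (Fin; toℕ)
open import Data.Product using (_×_; Σ; ∃; _,_)
open import Data.Sum using (_⊎_)
open import Data.List using (List; length)
open import Data.List.Membership.Propositional using (_∈_)
open import Data.List.Relation.Unary.Unique.Propositional using (Unique)
open import Relation.Binary.PropositionalEquality using (_≡_; _≢_)
open import Relation.Nullary using (¬_)

record Graph : Set₁ where
  field
    V   : Set
    Adj : V → V → Set
open Graph public

-- Cycle C_n on vertices Fin n (vertex i here stands for vertex i+1 of the paper):
-- i ~ j iff j ≡ i+1 (mod n) or i ≡ j+1 (mod n).
-- For n = 2 this gives exactly the single edge {0,1}, matching the paper's C_2.
Cycle : (n : ℕ) → .{{_ : NonZero n}} → Graph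
Cycle n = record
  { V   = Fin n
  ; Adj = λ i j → (toℕ j ≡ (toℕ i + 1) % n) ⊎ (toℕ i ≡ (toℕ j + 1) % n)
  }

Complete : ℕ → Graph
Complete m = record { V = Fin m ; Adj = λ i j → i ≢ j }

_⊠_ : Graph → Graph → Graph
G ⊠ H = record
  { V   = V G × V H
  ; Adj = λ x y → Adj G (Data.Product.proj₁ x) (Data.Product.proj₁ y)
                × Adj H (Data.Product.proj₂ x) (Data.Product.proj₂ y)
  }

DominatesP : (G : Graph) → (V G → Set) → Set
DominatesP G P = ∀ u → P u ⊎ Σ (V G) (λ v → P v × Adj G v u)

-- Finite vertex sets are duplicate-free lists; size = length.
IsDominating : (G : Graph) → List (V G) → Set
IsDominating G S = DominatesP G (λ u → u ∈ S)

Swap : {A : Set} → List A → A → A → A → Set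
Swap S v w u = (u ∈ S × u ≢ v) ⊎ u ≡ w

IsSecureDominating : (G : Graph) → List (V G) → Set
IsSecureDominating G S =
  IsDominating G S ×
  (∀ w → ¬ (w ∈ S) →
     Σ (V G) (λ v → v ∈ S × Adj G v w × DominatesP G (Swap S v w)))

SecureDomNumberIs : Graph → ℕ → Set
SecureDomNumberIs G k =
  Σ (List (V G)) (λ S → Unique S × IsSecureDominating G S × length S ≡ k)
  × (∀ (S : List (V G)) → Unique S → IsSecureDominating G S → k ≤ length S)

-- Let S be a secure dominating set of G × Kₘ, G loopless, and i a vertex of G. If at most two
-- vertices of S lie over the closed neighbourhood N[i], pick a label c different from theirs:
-- (i , c) ∉ S, and its defender v lies over a neighbour of i. After v is swapped for (i , c),
-- the set must still dominate the fibre {i} × Kₘ, which (i , c) and the one remaining vertex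
-- over N[i] cannot do when m ≥ 3. So S has at least three vertices over every N[i]. In Cₙ each
-- vertex lies in at most three of the sets N[i], and double counting gives 3n ≤ 3|S|. In C₂ the
-- set N[i] is everything, so |S| ≥ 3; for m ≥ 4 two of any three vertices share a fibre, and
-- the same swap leaves a label of that fibre undominated. The bounds are attained by the
-- section Cₙ × {0} (n ≥ 3), a fibre of C₂ × K₃, and C₂ × {0, 1}.
module Submission where

open import Algebra.Properties.CommutativeSemigroup using (interchange)
open import Data.Bool.Base using (true; false; if_then_else_)
open import Data.Empty using (⊥; ⊥-elim)
open import Data.Fin.Base using (Fin; zero; suc; toℕ; fromℕ<; fromℕ; inject₁; opposite)
open import Data.Fin.Patterns using (0F; 1F)
open import Data.Fin.Properties
  using (_≟_; toℕ-injective; toℕ<n; toℕ-fromℕ<; toℕ-fromℕ; toℕ-inject₁; pigeonhole; ¬∀⟶∃¬)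
import Data.Fin.Properties as Finₚ
open import Data.List.Base
  using (List; []; _∷_; length; map; filter; tabulate; lookup; allFin; cartesianProduct)
open import Data.List.Membership.Propositional using (_∈_; _∉_)
open import Data.List.Membership.Propositional.Properties
  using (∈-map⁺; ∈-filter⁺; ∈-tabulate⁺; ∈-allFin; ∈-cartesianProduct⁺)
open import Data.List.Properties using (length-map; filter-some; length-tabulate)
open import Data.List.Relation.Binary.Subset.Propositional using (_⊆_)
open import Data.List.Relation.Unary.All as All using (All; []; _∷_)
open import Data.List.Relation.Unary.AllPairs using ([]; _∷_)
open import Data.List.Relation.Unary.Any using (here; there; index)
open import Data.List.Relation.Unary.Any.Properties using (lookup-index)
open import Data.List.Relation.Unary.Unique.Propositional using (Unique)
import Data.List.Relation.Unary.Unique.Propositional.Properties as Uniqueₚ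
open import Data.Nat.Base using (ℕ; zero; suc; _+_; _*_; _%_; _≤_; _<_; _≥_; z≤n; s≤s; NonZero)
open import Data.Nat.DivMod using (m%n<n; m<n⇒m%n≡m; n%n≡0)
import Data.Nat.Properties as ℕ
open import Data.Nat.Properties
  using ( +-comm; *-identityʳ; +-mono-≤; *-cancelʳ-≤; suc-injective; 1+n≢0; 1+n≢n
        ; ≤-refl; ≤-reflexive; ≤-trans; ≤-pred; n≤1+n; n<1+n; m<n⇒m<1+n; m≤n⇒m<n∨m≡n
        ; <⇒≢; <⇒≱; ≮⇒≥; ≤∧≢⇒<; +-0-monoid; +-commutativeSemigroup; module ≤-Reasoning)
open import Algebra.Properties.Monoid.Sum +-0-monoid using (sum-syntax; sum-cong-≗; sum-replicate-zero)
open import Data.Product.Base using (_×_; _,_; proj₁; proj₂; ∃-syntax)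
open import Data.Sum.Base using (_⊎_; inj₁; inj₂)
open import Function.Base using (_∘_; id)
open import Relation.Binary.PropositionalEquality
  using (_≡_; _≢_; refl; sym; trans; cong; subst; module ≡-Reasoning)
open import Relation.Nullary using (¬_; Dec; does; yes; no)
open import Relation.Nullary.Decidable using (_⊎-dec_)
open import Relation.Unary using (Decidable)

open import Defs

private
  variable
    A : Set

-- Finite sets as lists

∀∈⇒n≤length : ∀ {n} (xs : List (Fin n)) → (∀ c → c ∈ xs) → n ≤ length xs
∀∈⇒n≤length xs ∈xs = ≮⇒≥ λ |xs|<n →
  let i , j , i<j , same = pigeonhole |xs|<n (index ∘ ∈xs)
  in Finₚ.<⇒≢ i<j (trans (lookup-index (∈xs i))
                   (trans (cong (lookup xs) same) (sym (lookup-index (∈xs j)))))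

∃∉ : ∀ {n} (xs : List (Fin n)) → length xs < n → ∃[ c ] c ∉ xs
∃∉ {n} xs |xs|<n = ¬∀⟶∃¬ n (_∈ xs) (_∈? xs) λ ∈xs → <⇒≱ |xs|<n (∀∈⇒n≤length xs ∈xs)
  where open import Data.List.Membership.DecPropositional (_≟_ {n}) using (_∈?_)

∃≢ : ∀ {m} → 2 ≤ m → (a : Fin m) → ∃[ c ] c ≢ a
∃≢ 2≤m a with ∃∉ (a ∷ []) 2≤m
... | c , c∉ = c , c∉ ∘ here

∃≢₂ : ∀ {m} → 3 ≤ m → (a b : Fin m) → ∃[ c ] c ≢ a × c ≢ b
∃≢₂ 3≤m a b with ∃∉ (a ∷ b ∷ []) 3≤m
... | c , c∉ = c , c∉ ∘ here , c∉ ∘ there ∘ here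

∈⇒⊆-pair : {v : A} {xs : List A} → v ∈ xs → length xs ≤ 2 → ∃[ q ] q ∈ xs × xs ⊆ v ∷ q ∷ []
∈⇒⊆-pair {xs = x ∷ []}        (here refl)         _ = x , here refl , there
∈⇒⊆-pair {xs = x ∷ y ∷ []}    (here refl)         _ = y , there (here refl) , id
∈⇒⊆-pair {xs = x ∷ y ∷ []}    (there (here refl)) _ =
  x , here refl , λ { (here e) → there (here e) ; (there (here e)) → here e }
∈⇒⊆-pair {xs = _ ∷ _ ∷ _ ∷ _} _ (s≤s (s≤s ()))

-- Counting

⟦_⟧ : {P : Set} → Dec P → ℕ
⟦ P? ⟧ = if does P? then 1 else 0

count : {P : A → Set} → Decidable P → List A → ℕ
count P? xs = length (filter P? xs)

count-∷ : {P : A → Set} (P? : Decidable P) (x : A) (xs : List A) →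
          count P? (x ∷ xs) ≡ ⟦ P? x ⟧ + count P? xs
count-∷ P? x xs with does (P? x)
... | true  = refl
... | false = refl

sum-+ : ∀ {n} (f g : Fin n → ℕ) → ∑[ i < n ] (f i + g i) ≡ ∑[ i < n ] f i + ∑[ i < n ] g i
sum-+ {zero}  f g = refl
sum-+ {suc n} f g = trans (cong (f zero + g zero +_) (sum-+ (f ∘ suc) (g ∘ suc)))
                          (interchange +-commutativeSemigroup (f zero) (g zero) _ _)

sum-mono-≤ : ∀ {n} {f g : Fin n → ℕ} → (∀ i → f i ≤ g i) → ∑[ i < n ] f i ≤ ∑[ i < n ] g i
sum-mono-≤ {zero}  f≤g = z≤n
sum-mono-≤ {suc n} f≤g = +-mono-≤ (f≤g zero) (sum-mono-≤ (f≤g ∘ suc))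

*≤sum : ∀ {n a} {f : Fin n → ℕ} → (∀ i → a ≤ f i) → n * a ≤ ∑[ i < n ] f i
*≤sum {zero}  a≤f = z≤n
*≤sum {suc n} a≤f = +-mono-≤ (a≤f zero) (*≤sum (a≤f ∘ suc))

sum-⟦≟⟧ : ∀ {n} (t : Fin n) → ∑[ i < n ] ⟦ i ≟ t ⟧ ≡ 1
sum-⟦≟⟧ {suc n} zero    = cong suc (sum-replicate-zero n)
sum-⟦≟⟧ {suc n} (suc t) = sum-⟦≟⟧ t

module _ {n : ℕ} {R : Fin n → A → Set} (R? : ∀ i → Decidable (R i)) where

  double-count : ∀ {b} → (∀ x → ∑[ i < n ] ⟦ R? i x ⟧ ≤ b) →
                 ∀ xs → ∑[ i < n ] count (R? i) xs ≤ length xs * b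
  double-count bound []           = ≤-reflexive (sum-replicate-zero n)
  double-count {b} bound (x ∷ xs) = begin
    ∑[ i < n ] count (R? i) (x ∷ xs)                   ≡⟨ sum-cong-≗ (λ i → count-∷ (R? i) x xs) ⟩
    ∑[ i < n ] (⟦ R? i x ⟧ + count (R? i) xs)           ≡⟨ sum-+ (λ i → ⟦ R? i x ⟧) (λ i → count (R? i) xs) ⟩
    ∑[ i < n ] ⟦ R? i x ⟧ + ∑[ i < n ] count (R? i) xs  ≤⟨ +-mono-≤ (bound x) (double-count bound xs) ⟩
    b + length xs * b                                   ∎
    where open ≤-Reasoning

sum-⟦⟧≤length : ∀ {n} {P : Fin n → Set} (P? : Decidable P) (ts : List (Fin n)) →
                (∀ i → P i → i ∈ ts) → ∑[ i < n ] ⟦ P? i ⟧ ≤ length ts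
sum-⟦⟧≤length {n} P? ts P⊆ts = begin
  ∑[ i < n ] ⟦ P? i ⟧         ≤⟨ sum-mono-≤ ⟦P?⟧≤count ⟩
  ∑[ i < n ] count (i ≟_) ts  ≤⟨ double-count _≟_ (λ t → ≤-reflexive (sum-⟦≟⟧ t)) ts ⟩
  length ts * 1               ≡⟨ *-identityʳ (length ts) ⟩
  length ts                   ∎
  where
  open ≤-Reasoning
  ⟦P?⟧≤count : ∀ i → ⟦ P? i ⟧ ≤ count (i ≟_) ts
  ⟦P?⟧≤count i with P? i
  ... | yes Pi = filter-some (i ≟_) (P⊆ts i Pi)
  ... | no  _  = z≤n

-- Secure domination in G × Kₘ

ClosedNbhd : (G : Graph) → V G → V G → Set
ClosedNbhd G i j = j ≡ i ⊎ Adj G j i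

Covers : (G : Graph) {B : Set} → V G → (V G × B → Set) → List (V G × B) → Set
Covers G i D T = ∀ z → D z → ClosedNbhd G i (proj₁ z) → z ∈ T

dominating⇒fibre⊆ : (G H : Graph) {D : V G × V H → Set} (i : V G) → DominatesP (G ⊠ H) D →
                    (∀ z → D z → ¬ Adj G (proj₁ z) i) → ∀ x → D (i , x)
dominating⇒fibre⊆ G H i dom D≁i x with dom (i , x)
... | inj₁ Dix                = Dix
... | inj₂ (z , Dz , z~i , _) = ⊥-elim (D≁i z Dz z~i)

module _ (G : Graph) (loopless : ∀ i → ¬ Adj G i i) {m : ℕ} where

  private
    G×Kₘ : Graph
    G×Kₘ = G ⊠ Complete m

  m≤cover-length : ∀ {D i U} → DominatesP G×Kₘ D → Covers G i D U →
                   (∀ u → u ∈ U → ¬ Adj G (proj₁ u) i) → m ≤ length U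
  m≤cover-length {D} {i} {U} dom cover U≁i =
    subst (m ≤_) (length-map proj₂ U)
      (∀∈⇒n≤length (map proj₂ U) λ x → ∈-map⁺ proj₂ (cover (i , x) (fibre x) (inj₁ refl)))
    where
    fibre : ∀ x → D (i , x)
    fibre = dominating⇒fibre⊆ G (Complete m) i dom λ z Dz z~i → U≁i z (cover z Dz (inj₂ z~i)) z~i

  ∃-fresh-label : (T : List (V G × Fin m)) → length T < m → ∃[ c ] c ∉ map proj₂ T
  ∃-fresh-label T |T|<m = ∃∉ (map proj₂ T) (subst (_< m) (sym (length-map proj₂ T)) |T|<m)

  secure⇒defender : ∀ {S i T c} → IsSecureDominating G×Kₘ S → Covers G i (_∈ S) T →
                    c ∉ map proj₂ T →
                    ∃[ v ] v ∈ T × Adj G (proj₁ v) i × DominatesP G×Kₘ (Swap S v (i , c))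
  secure⇒defender {i = i} {c = c} (_ , secure) cover c∉T
    with secure (i , c) (λ w∈S → c∉T (∈-map⁺ proj₂ (cover _ w∈S (inj₁ refl))))
  ... | v , v∈S , (v~i , _) , dom = v , cover v v∈S (inj₂ v~i) , v~i , dom

  Swap-covers : ∀ {S : List (V G × Fin m)} {i v w U} →
                Covers G i (_∈ S) (v ∷ U) → Covers G i (Swap S v w) (w ∷ U)
  Swap-covers cover z (inj₁ (z∈S , z≢v)) near with cover z z∈S near
  ... | here z≡v  = ⊥-elim (z≢v z≡v)
  ... | there z∈U = there z∈U
  Swap-covers cover z (inj₂ refl) near = here refl

  pair-cover⇒¬dominating : ∀ {D i c q} → 3 ≤ m → DominatesP G×Kₘ D →
                           Covers G i D ((i , c) ∷ q ∷ []) → c ≢ proj₂ q → ⊥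
  pair-cover⇒¬dominating {D} {i} {c} {q} 3≤m dom cover c≢b =
    <⇒≱ 3≤m (m≤cover-length dom cover off)
    where
    -- otherwise nothing dominates (i , proj₂ q): q has the same label, (i , c) the same fibre
    q≁i : ¬ Adj G (proj₁ q) i
    q≁i q~i with dom (i , proj₂ q)
    ... | inj₁ Dib with cover _ Dib (inj₁ refl)
    ...   | here ib≡ic        = c≢b (sym (cong proj₂ ib≡ic))
    ...   | there (here refl) = loopless i q~i
    q≁i q~i | inj₂ (z , Dz , z~i , z≢b) with cover z Dz (inj₂ z~i)
    ...   | here refl         = loopless i z~i
    ...   | there (here refl) = z≢b refl
    off : ∀ u → u ∈ (i , c) ∷ q ∷ [] → ¬ Adj G (proj₁ u) i
    off _ (here refl)         = loopless i
    off _ (there (here refl)) = q≁i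

  secure⇒3≤cover-length : ∀ {S i T} → 3 ≤ m → IsSecureDominating G×Kₘ S →
                          Covers G i (_∈ S) T → 3 ≤ length T
  secure⇒3≤cover-length {S} {i} {T} 3≤m sd cover = ≮⇒≥ short
    where
    short : length T < 3 → ⊥
    short |T|<3 with ∃-fresh-label T (≤-trans |T|<3 3≤m)
    ... | c , c∉T with secure⇒defender sd cover c∉T
    ...   | v , v∈T , _ , dom with ∈⇒⊆-pair v∈T (≤-pred |T|<3)
    ...     | q , q∈T , T⊆vq =
      pair-cover⇒¬dominating 3≤m dom (Swap-covers λ z z∈S near → T⊆vq (cover z z∈S near))
        λ c≡b → c∉T (subst (_∈ map proj₂ T) (sym c≡b) (∈-map⁺ proj₂ q∈T))

  -- The defender of (i , c) lies off the fibre of i, so it is p; after the swap, every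
  -- vertex over N[i] lies in that fibre.
  secure⇒m≤cover-length : ∀ {S i p U} → IsSecureDominating G×Kₘ S → Covers G i (_∈ S) (p ∷ U) →
                          All (λ u → proj₁ u ≡ i) U → m ≤ length (p ∷ U)
  secure⇒m≤cover-length {S} {i} {p} {U} sd cover U⊆Fᵢ = ≮⇒≥ short
    where
    short : length (p ∷ U) < m → ⊥
    short |T|<m with ∃-fresh-label (p ∷ U) |T|<m
    ... | c , c∉T with secure⇒defender sd cover c∉T
    ...   | _ , there v∈U , v~i , _ = loopless i (subst (λ j → Adj G j i) (All.lookup U⊆Fᵢ v∈U) v~i)
    ...   | _ , here refl , _ , dom = <⇒≱ |T|<m (m≤cover-length dom (Swap-covers cover) off)
      where
      off : ∀ u → u ∈ (i , c) ∷ U → ¬ Adj G (proj₁ u) i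
      off _ (here refl) = loopless i
      off _ (there u∈U) = subst (λ j → ¬ Adj G j i) (sym (All.lookup U⊆Fᵢ u∈U)) (loopless i)

-- Cycles

next : ∀ {n} .{{_ : NonZero n}} → Fin n → Fin n
next {n} i = fromℕ< (m%n<n (toℕ i + 1) n)

prev : ∀ {n} → Fin n → Fin n
prev {suc n} zero    = fromℕ n
prev {suc n} (suc i) = inject₁ i

next-prev : ∀ {n} .{{_ : NonZero n}} (i : Fin n) → next (prev i) ≡ i
next-prev {suc n} i = toℕ-injective (trans (toℕ-fromℕ< _) (toℕ-prev+1 i))
  where
  toℕ-prev+1 : ∀ i → (toℕ (prev i) + 1) % suc n ≡ toℕ i
  toℕ-prev+1 zero    = trans (cong (λ t → (t + 1) % suc n) (toℕ-fromℕ n))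
                             (trans (cong (_% suc n) (+-comm n 1)) (n%n≡0 (suc n)))
  toℕ-prev+1 (suc i) = trans (cong (λ t → (t + 1) % suc n) (toℕ-inject₁ i))
                             (trans (cong (_% suc n) (+-comm (toℕ i) 1)) (m<n⇒m%n≡m (toℕ<n (suc i))))

module _ {n : ℕ} .{{_ : NonZero n}} where

  +1-mod : ∀ {t} → t < n → (t + 1) % n ≡ suc t × suc t < n ⊎ (t + 1) % n ≡ 0 × suc t ≡ n
  +1-mod {t} t<n with m≤n⇒m<n∨m≡n t<n
  ... | inj₁ 1+t<n = inj₁ (trans (cong (_% n) (+-comm t 1)) (m<n⇒m%n≡m 1+t<n) , 1+t<n)
  ... | inj₂ 1+t≡n = inj₂ (trans (cong (_% n) (trans (+-comm t 1) 1+t≡n)) (n%n≡0 n) , 1+t≡n)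

  +1-mod-injective : ∀ {s t} → s < n → t < n → (s + 1) % n ≡ (t + 1) % n → s ≡ t
  +1-mod-injective s<n t<n e with +1-mod s<n | +1-mod t<n
  ... | inj₁ (eₛ , _) | inj₁ (eₜ , _) = suc-injective (trans (sym eₛ) (trans e eₜ))
  ... | inj₁ (eₛ , _) | inj₂ (eₜ , _) = ⊥-elim (1+n≢0 (trans (sym eₛ) (trans e eₜ)))
  ... | inj₂ (eₛ , _) | inj₁ (eₜ , _) = ⊥-elim (1+n≢0 (trans (sym eₜ) (trans (sym e) eₛ)))
  ... | inj₂ (_ , nₛ) | inj₂ (_ , nₜ) = suc-injective (trans nₛ (sym nₜ))

  +1-mod≢ : 2 ≤ n → ∀ {t} → t < n → (t + 1) % n ≢ t
  +1-mod≢ 2≤n t<n e with +1-mod t<n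
  ... | inj₁ (e₁ , _)     = 1+n≢n (trans (sym e₁) e)
  ... | inj₂ (e₀ , 1+t≡n) =
    <⇒≱ 2≤n (≤-reflexive (trans (sym 1+t≡n) (cong suc (sym (trans (sym e₀) e)))))

  +2-mod≢ : 3 ≤ n → ∀ {t} → t < n → ((t + 1) % n + 1) % n ≢ t
  +2-mod≢ 3≤n {t} t<n e with +1-mod t<n
  ... | inj₂ (e₀ , 1+t≡n) = <⇒≱ 3≤n (≤-reflexive (trans (sym 1+t≡n) (cong suc (sym 1≡t))))
    where
    1≡t : 1 ≡ t
    1≡t = trans (sym (m<n⇒m%n≡m (≤-trans (n≤1+n 2) 3≤n)))
                (trans (cong (λ u → (u + 1) % n) (sym e₀)) e)
  ... | inj₁ (e₁ , 1+t<n) with +1-mod 1+t<n | trans (cong (λ u → (u + 1) % n) (sym e₁)) e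
  ...   | inj₁ (e₂ , _)     | e′ = <⇒≢ (m<n⇒m<1+n (n<1+n t)) (trans (sym e′) e₂)
  ...   | inj₂ (e₀ , 2+t≡n) | e′ =
    <⇒≱ 3≤n (≤-reflexive (trans (sym 2+t≡n) (cong (λ u → suc (suc u)) (sym (trans (sym e₀) e′)))))

  toℕ-next : ∀ i → toℕ (next {n} i) ≡ (toℕ i + 1) % n
  toℕ-next i = toℕ-fromℕ< _

  adj-next : ∀ i → Adj (Cycle n) i (next i)
  adj-next i = inj₁ (toℕ-next i)

  next-adj : ∀ i → Adj (Cycle n) (next i) i
  next-adj i = inj₂ (toℕ-next i)

  prev-adj : ∀ i → Adj (Cycle n) (prev i) i
  prev-adj i = subst (Adj (Cycle n) (prev i)) (next-prev i) (adj-next (prev i))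

  adj⇒next : ∀ {i j} → Adj (Cycle n) i j → j ≡ next i ⊎ i ≡ next j
  adj⇒next {i} {j} (inj₁ e) = inj₁ (toℕ-injective (trans e (sym (toℕ-next i))))
  adj⇒next {i} {j} (inj₂ e) = inj₂ (toℕ-injective (trans e (sym (toℕ-next j))))

  next-injective : ∀ {i j} → next i ≡ next j → i ≡ j
  next-injective {i} {j} eq = toℕ-injective (+1-mod-injective (toℕ<n i) (toℕ<n j)
    (trans (sym (toℕ-next i)) (trans (cong toℕ eq) (toℕ-next j))))

  Cycle-loopless : 2 ≤ n → ∀ i → ¬ Adj (Cycle n) i i
  Cycle-loopless 2≤n i (inj₁ e) = +1-mod≢ 2≤n (toℕ<n i) (sym e)
  Cycle-loopless 2≤n i (inj₂ e) = +1-mod≢ 2≤n (toℕ<n i) (sym e)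

  prev≢next : 3 ≤ n → ∀ i → prev i ≢ next i
  prev≢next 3≤n i prev≡next = +2-mod≢ 3≤n (toℕ<n i) (begin
    ((toℕ i + 1) % n + 1) % n  ≡⟨ cong (λ u → (u + 1) % n) (toℕ-next i) ⟨
    (toℕ (next i) + 1) % n     ≡⟨ toℕ-next (next i) ⟨
    toℕ (next (next i))        ≡⟨ cong (toℕ ∘ next) prev≡next ⟨
    toℕ (next (prev i))        ≡⟨ cong toℕ (next-prev i) ⟩
    toℕ i                      ∎)
    where open ≡-Reasoning

  adj⇒∈neighbours : ∀ {i j} → Adj (Cycle n) j i → i ∈ next j ∷ prev j ∷ []
  adj⇒∈neighbours {i} {j} j~i with adj⇒next j~i
  ... | inj₁ i≡next-j = here i≡next-j
  ... | inj₂ j≡next-i = there (here (next-injective (trans (sym j≡next-i) (sym (next-prev j)))))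

  near? : ∀ i j → Dec (ClosedNbhd (Cycle n) i j)
  near? i j = (j ≟ i) ⊎-dec ((toℕ i ℕ.≟ (toℕ j + 1) % n) ⊎-dec (toℕ j ℕ.≟ (toℕ i + 1) % n))

  Cycle-secure⇒n≤length : ∀ {m} {S : List (Fin n × Fin m)} → 2 ≤ n → 3 ≤ m →
                          IsSecureDominating (Cycle n ⊠ Complete m) S → n ≤ length S
  Cycle-secure⇒n≤length {m} {S} 2≤n 3≤m sd = *-cancelʳ-≤ n (length S) 3 (begin
    n * 3                           ≤⟨ *≤sum three-in-window ⟩
    ∑[ i < n ] count (window? i) S  ≤⟨ double-count window? in-three-windows S ⟩
    length S * 3                    ∎)
    where
    open ≤-Reasoning
    window? : ∀ i → Decidable (λ (z : Fin n × Fin m) → ClosedNbhd (Cycle n) i (proj₁ z))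
    window? i z = near? i (proj₁ z)
    three-in-window : ∀ i → 3 ≤ count (window? i) S
    three-in-window i = secure⇒3≤cover-length (Cycle n) (Cycle-loopless 2≤n) 3≤m sd
                          λ z z∈S near → ∈-filter⁺ (window? i) z∈S near
    in-three-windows : ∀ z → ∑[ i < n ] ⟦ window? i z ⟧ ≤ 3
    in-three-windows (j , _) = sum-⟦⟧≤length (λ i → near? i j) (j ∷ next j ∷ prev j ∷ [])
      λ { i (inj₁ j≡i) → here (sym j≡i) ; i (inj₂ j~i) → there (adj⇒∈neighbours j~i) }

module _ {n : ℕ} .{{_ : NonZero n}} {m : ℕ} (o : Fin m) where

  section : List (Fin n × Fin m)
  section = tabulate (_, o)

  ∈-section : ∀ i → (i , o) ∈ section
  ∈-section i = ∈-tabulate⁺ i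

  section-unique : Unique section
  section-unique = Uniqueₚ.tabulate⁺ (cong proj₁)

  length-section : length section ≡ n
  length-section = length-tabulate (_, o)

  section-dominating : IsDominating (Cycle n ⊠ Complete m) section
  section-dominating (i , a) with a ≟ o
  ... | yes refl = inj₁ (∈-section i)
  ... | no  a≢o  = inj₂ ((next i , o) , ∈-section (next i) , next-adj i , a≢o ∘ sym)

  section-secure : 3 ≤ n → IsSecureDominating (Cycle n ⊠ Complete m) section
  section-secure 3≤n = section-dominating , defend
    where
    defend : ∀ w → w ∉ section → ∃[ v ] v ∈ section × Adj (Cycle n ⊠ Complete m) v w ×
                                         DominatesP (Cycle n ⊠ Complete m) (Swap section v w)
    defend (i , a) w∉S = (next i , o) , ∈-section (next i) , (next-adj i , a≢o ∘ sym) , swapped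
      where
      a≢o : a ≢ o
      a≢o refl = w∉S (∈-section i)
      swapped : DominatesP (Cycle n ⊠ Complete m) (Swap section (next i , o) (i , a))
      swapped (k , b) with b ≟ o | k ≟ next i | k ≟ i
      ... | yes refl | yes refl | _ = inj₂ ((i , a) , inj₂ refl , adj-next i , a≢o)
      ... | yes refl | no  k≢   | _ = inj₁ (inj₁ (∈-section k , k≢ ∘ cong proj₁))
      ... | no  b≢o  | _ | yes refl = inj₂ ((prev i , o)
          , inj₁ (∈-section (prev i) , prev≢next 3≤n i ∘ cong proj₁) , prev-adj i , b≢o ∘ sym)
      ... | no  b≢o  | _ | no  k≢i  = inj₂ ((next k , o)
          , inj₁ (∈-section (next k) , k≢i ∘ next-injective ∘ cong proj₁) , next-adj k , b≢o ∘ sym)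

-- The cycle C₂

C₂-adj : ∀ {i j : Fin 2} → i ≢ j → Adj (Cycle 2) i j
C₂-adj {0F} {0F} i≢j = ⊥-elim (i≢j refl)
C₂-adj {0F} {1F} _   = inj₁ refl
C₂-adj {1F} {0F} _   = inj₁ refl
C₂-adj {1F} {1F} i≢j = ⊥-elim (i≢j refl)

C₂-loopless : ∀ i → ¬ Adj (Cycle 2) i i
C₂-loopless = Cycle-loopless ≤-refl

opposite-≢ : (i : Fin 2) → opposite i ≢ i
opposite-≢ 0F ()
opposite-≢ 1F ()

Fin2-pigeonhole : (a b c : Fin 2) → a ≡ b ⊎ a ≡ c ⊎ b ≡ c
Fin2-pigeonhole 0F 0F _  = inj₁ refl
Fin2-pigeonhole 1F 1F _  = inj₁ refl
Fin2-pigeonhole 0F 1F 0F = inj₂ (inj₁ refl)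
Fin2-pigeonhole 0F 1F 1F = inj₂ (inj₂ refl)
Fin2-pigeonhole 1F 0F 0F = inj₂ (inj₂ refl)
Fin2-pigeonhole 1F 0F 1F = inj₂ (inj₁ refl)

module _ {m : ℕ} where

  private
    C₂×Kₘ : Graph
    C₂×Kₘ = Cycle 2 ⊠ Complete m

  C₂-secure⇒3≤length : ∀ {S} → 3 ≤ m → IsSecureDominating C₂×Kₘ S → 3 ≤ length S
  C₂-secure⇒3≤length 3≤m sd =
    secure⇒3≤cover-length (Cycle 2) C₂-loopless {i = 0F} 3≤m sd λ _ z∈S _ → z∈S

  C₂-¬secure-⊆-triple : 4 ≤ m → ∀ {S p u u′} → IsSecureDominating C₂×Kₘ S →
                        S ⊆ p ∷ u ∷ u′ ∷ [] → proj₁ u ≡ proj₁ u′ → ⊥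
  C₂-¬secure-⊆-triple 4≤m sd S⊆ u≡u′ = <⇒≱ 4≤m
    (secure⇒m≤cover-length (Cycle 2) C₂-loopless sd (λ _ w∈S _ → S⊆ w∈S) (refl ∷ sym u≡u′ ∷ []))

  C₂-¬secure-triple : 4 ≤ m → ∀ x y z → ¬ IsSecureDominating C₂×Kₘ (x ∷ y ∷ z ∷ [])
  C₂-¬secure-triple 4≤m x y z sd with Fin2-pigeonhole (proj₁ x) (proj₁ y) (proj₁ z)
  ... | inj₁ x≡y = C₂-¬secure-⊆-triple 4≤m sd
    (λ { (here e) → there (here e) ; (there (here e)) → there (there (here e))
       ; (there (there (here e))) → here e })
    x≡y
  ... | inj₂ (inj₁ x≡z) = C₂-¬secure-⊆-triple 4≤m sd
    (λ { (here e) → there (here e) ; (there (here e)) → here e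
       ; (there (there (here e))) → there (there (here e)) })
    x≡z
  ... | inj₂ (inj₂ y≡z) = C₂-¬secure-⊆-triple 4≤m sd id y≡z

  C₂-secure⇒4≤length : ∀ {S} → 4 ≤ m → IsSecureDominating C₂×Kₘ S → 4 ≤ length S
  C₂-secure⇒4≤length {S} 4≤m sd =
    ≤∧≢⇒< (C₂-secure⇒3≤length (≤-trans (n≤1+n 3) 4≤m) sd) (not-three S sd)
    where
    not-three : ∀ S → IsSecureDominating C₂×Kₘ S → 3 ≢ length S
    not-three (x ∷ y ∷ z ∷ []) sd refl = C₂-¬secure-triple 4≤m x y z sd

  column : List (Fin 2 × Fin m)
  column = tabulate (0F ,_)

  ∈-column : ∀ a → (0F , a) ∈ column
  ∈-column a = ∈-tabulate⁺ a

  column-unique : Unique column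
  column-unique = Uniqueₚ.tabulate⁺ (cong proj₂)

  length-column : length column ≡ m
  length-column = length-tabulate (0F ,_)

  column-secure : 3 ≤ m → IsSecureDominating C₂×Kₘ column
  column-secure 3≤m = dominating , defend
    where
    2≤m : 2 ≤ m
    2≤m = ≤-trans (n≤1+n 2) 3≤m
    dominating : IsDominating C₂×Kₘ column
    dominating (0F , a) = inj₁ (∈-column a)
    dominating (1F , b) with ∃≢ 2≤m b
    ... | c , c≢b = inj₂ ((0F , c) , ∈-column c , inj₁ refl , c≢b)
    defend : ∀ w → w ∉ column →
             ∃[ v ] v ∈ column × Adj C₂×Kₘ v w × DominatesP C₂×Kₘ (Swap column v w)
    defend (0F , b) w∉S = ⊥-elim (w∉S (∈-column b))
    defend (1F , b) w∉S with ∃≢ 2≤m b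
    ... | a , a≢b = (0F , a) , ∈-column a , (inj₁ refl , a≢b) , swapped
      where
      swapped : DominatesP C₂×Kₘ (Swap column (0F , a) (1F , b))
      swapped (0F , d) with d ≟ a
      ... | yes refl = inj₂ ((1F , b) , inj₂ refl , inj₁ refl , a≢b ∘ sym)
      ... | no  d≢a  = inj₁ (inj₁ (∈-column d , d≢a ∘ cong proj₂))
      swapped (1F , d) with d ≟ b
      ... | yes refl = inj₁ (inj₂ refl)
      ... | no  d≢b  with ∃≢₂ 3≤m a d
      ...   | e , e≢a , e≢d = inj₂ ((0F , e) , inj₁ (∈-column e , e≢a ∘ cong proj₂) , inj₁ refl , e≢d)

module _ {k : ℕ} where

  private
    C₂×Kₘ : Graph
    C₂×Kₘ = Cycle 2 ⊠ Complete (suc (suc k))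

  square : List (Fin 2 × Fin (suc (suc k)))
  square = cartesianProduct (allFin 2) (0F ∷ 1F ∷ [])

  ∈-square : ∀ i {a} → a ∈ 0F ∷ 1F ∷ [] → (i , a) ∈ square
  ∈-square i = ∈-cartesianProduct⁺ (∈-allFin i)

  square-unique : Unique square
  square-unique = Uniqueₚ.cartesianProduct⁺ (Uniqueₚ.allFin⁺ 2) (((λ ()) ∷ []) ∷ [] ∷ [])

  square-secure : IsSecureDominating C₂×Kₘ square
  square-secure = dominating , defend
    where
    dominating : IsDominating C₂×Kₘ square
    dominating (i , 0F)          = inj₁ (∈-square i (here refl))
    dominating (i , 1F)          = inj₁ (∈-square i (there (here refl)))
    dominating (i , suc (suc _)) =
      inj₂ ((opposite i , 0F) , ∈-square (opposite i) (here refl) , C₂-adj (opposite-≢ i) , λ ())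
    defend : ∀ w → w ∉ square →
             ∃[ v ] v ∈ square × Adj C₂×Kₘ v w × DominatesP C₂×Kₘ (Swap square v w)
    defend (i , 0F)          w∉S = ⊥-elim (w∉S (∈-square i (here refl)))
    defend (i , 1F)          w∉S = ⊥-elim (w∉S (∈-square i (there (here refl))))
    defend (i , suc (suc b)) _   =
      (opposite i , 0F) , ∈-square (opposite i) (here refl) , (C₂-adj (opposite-≢ i) , λ ()) , swapped
      where
      ≢defender : ∀ {a} → (i , a) ≢ (opposite i , 0F)
      ≢defender = opposite-≢ i ∘ sym ∘ cong proj₁
      swapped : DominatesP C₂×Kₘ (Swap square (opposite i , 0F) (i , suc (suc b)))
      swapped (j , d) with j ≟ i
      swapped (j , 0F)          | yes refl = inj₁ (inj₁ (∈-square i (here refl) , ≢defender))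
      swapped (j , 1F)          | yes refl = inj₁ (inj₁ (∈-square i (there (here refl)) , ≢defender))
      swapped (j , suc (suc _)) | yes refl = inj₂ ((opposite i , 1F)
        , inj₁ (∈-square (opposite i) (there (here refl)) , λ ()) , C₂-adj (opposite-≢ i) , λ ())
      swapped (j , 0F)          | no  j≢i  = inj₂ ((i , suc (suc b)) , inj₂ refl , C₂-adj (j≢i ∘ sym) , λ ())
      swapped (j , 1F)          | no  j≢i  = inj₁ (inj₁ (∈-square j (there (here refl)) , λ ()))
      swapped (j , suc (suc _)) | no  j≢i  =
        inj₂ ((i , 0F) , inj₁ (∈-square i (here refl) , ≢defender) , C₂-adj (j≢i ∘ sym) , λ ())

theorem5p2 : (m : ℕ) → m ≥ 3 →
    ((n : ℕ) → .{{_ : NonZero n}} → n ≥ 3 → SecureDomNumberIs (Cycle n ⊠ Complete m) n)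
    × (m ≡ 3 → SecureDomNumberIs (Cycle 2 ⊠ Complete m) 3)
    × (m ≥ 4 → SecureDomNumberIs (Cycle 2 ⊠ Complete m) 4)
theorem5p2 m 3≤m@(s≤s (s≤s _)) = part-i , part-ii-3 , part-ii-4
  where
  part-i : (n : ℕ) → .{{_ : NonZero n}} → n ≥ 3 → SecureDomNumberIs (Cycle n ⊠ Complete m) n
  part-i n 3≤n = (section 0F , section-unique 0F , section-secure 0F 3≤n , length-section 0F)
               , λ _ _ → Cycle-secure⇒n≤length (≤-trans (n≤1+n 2) 3≤n) 3≤m
  part-ii-3 : m ≡ 3 → SecureDomNumberIs (Cycle 2 ⊠ Complete m) 3
  part-ii-3 m≡3 = (column , column-unique , column-secure 3≤m , trans length-column m≡3)
                , λ _ _ → C₂-secure⇒3≤length 3≤m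
  part-ii-4 : m ≥ 4 → SecureDomNumberIs (Cycle 2 ⊠ Complete m) 4
  part-ii-4 4≤m = (square , square-unique , square-secure , refl)
                , λ _ _ → C₂-secure⇒4≤length 4≤m
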